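{- Let $n\geq 1$ and $N_0$ be integers, and let $p_0(t),\dots,p_{n-1}(t)\in\mathbb{Z}[t]$ be polynomials, parametrizing the family $\{f_a(x)=x^n+p_{n-1}(a)x^{n-1}+\dots+p_1(a)x+p_0(a): a\in\mathbb{Z}_{\geq N_0}\}$, such that $p_j(t)$ is nonconstant for some $0\leq j\leq n-1$. Then for every integer $N\geq1$ there is an integer $k\geq 1$ such that the polynomial $Q_{kN}(p_0(x),\dots,p_{n-1}(x))\in\mathbb{Z}[x]$ is nonconstant.
   Context: For integers $m,n\geq1$, $Q_m(x_0,\dots,x_{n-1})\in\mathbb{Z}[x_0,\dots,x_{n-1}]$ denotes the (unique) polynomial such that for all complex $a_0,\dots,a_{n-1}$, $Q_m(a_0,\dots,a_{n-1})=\alpha_1^m+\dots+\alpha_n^m$, where $\alpha_1,\dots,\alpha_n$ are the roots (with multiplicity) of $x^n+a_{n-1}x^{n-1}+\dots+a_1x+a_0$; equivalently, $Q_m$ expresses the $m$-th power sum $x_1^m+\dots+x_n^m$ in terms of the elementary symmetric polynomials via $s_k=(-1)^k a_{n-k}$. -}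

module Defs where

open import Data.Nat using (ℕ; zero; suc)
open import Data.Integer using (ℤ; +_; 0ℤ) renaming (_+_ to _+ℤ_; _*_ to _*ℤ_; -_ to -ℤ_)
open import Data.List using (List; []; _∷_; map; reverse)
open import Data.List.Base using (allFin)
open import Data.Fin using (Fin)
open import Data.Product using (∃)
open import Relation.Binary.PropositionalEquality using (_≢_)

-- Univariate integer polynomials as coefficient lists, lowest degree first
-- (trailing zeros allowed; all notions below are insensitive to them).
Poly : Set
Poly = List ℤ

coeff : Poly → ℕ → ℤ
coeff []       _       = 0ℤ
coeff (a ∷ _)  zero    = a
coeff (_ ∷ as) (suc i) = coeff as i

0ᴾ : Poly
0ᴾ = []

infixl 6 _+ᴾ_
infixl 7 _*ᴾ_ _·ᴾ_

_+ᴾ_ : Poly → Poly → Poly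
[]       +ᴾ q        = q
(a ∷ p)  +ᴾ []       = a ∷ p
(a ∷ p)  +ᴾ (b ∷ q)  = (a +ℤ b) ∷ (p +ᴾ q)

_·ᴾ_ : ℤ → Poly → Poly
c ·ᴾ p = map (c *ℤ_) p

negᴾ : Poly → Poly
negᴾ p = map -ℤ_ p

_*ᴾ_ : Poly → Poly → Poly
[]      *ᴾ q = []
(a ∷ p) *ᴾ q = (a ·ᴾ q) +ᴾ (0ℤ ∷ (p *ᴾ q))

Nonconstant : Poly → Set
Nonconstant p = ∃ λ i → coeff p (suc i) ≢ 0ℤ

nth : {A : Set} → List A → A → ℕ → A
nth []       d _       = d
nth (x ∷ _)  d zero    = x
nth (_ ∷ xs) d (suc i) = nth xs d i

module PowerSums (n : ℕ) (a : Fin n → Poly) where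
  cs : List Poly
  cs = reverse (map a (allFin n))

  -- c i = a_{n-i} for 1 ≤ i ≤ n (so s_i = (-1)^i c_i), and c i = 0 for i > n.
  c : ℕ → Poly
  c zero    = 0ᴾ
  c (suc i) = nth cs 0ᴾ i

  dot : ℕ → List Poly → Poly
  dot i []       = 0ᴾ
  dot i (x ∷ xs) = c (suc i) *ᴾ x +ᴾ dot (suc i) xs

  -- psRev m = [P_m, P_{m-1}, ..., P_1], via Newton's identities
  --   P_m + c_1 P_{m-1} + ... + c_{m-1} P_1 + m c_m = 0.
  psRev : ℕ → List Poly
  psRev zero    = []
  psRev (suc m) = negᴾ (dot 0 (psRev m) +ᴾ (+ suc m) ·ᴾ c (suc m)) ∷ psRev m

-- Q m n a = Q_m(a_0, ..., a_{n-1}) evaluated at polynomials a_j ∈ ℤ[x]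
-- (meaningful for m ≥ 1; Q 0 is set to 0 and never used).
Q : ℕ → (n : ℕ) → (Fin n → Poly) → Poly
Q m n a = nth (PowerSums.psRev n a m) 0ᴾ 0

-- Choose (i₀ , d) maximising the slope d / i₀ over the monomials x^d of the coefficients c i₀ (the steepest
-- edge of a Newton polygon). Weighting x by i₀ and c i by d·i, every c i has weighted degree ≤ i, so Q m,
-- being isobaric of weight m, has weighted degree ≤ m, and its coefficient of weight d·m is the power sum P m
-- of the roots of the integer polynomial with coefficients h i, the weight-(d·i) coefficients of the c i.
-- Since h i₀ ≠ 0 this polynomial has s ≥ 1 nonzero roots; their power sums obey a linear recurrence of order s
-- whose last coefficient h s is a unit modulo M = 1 + s·(h s)². So the recurrence runs backwards mod M, and by
-- pigeonhole two windows of s consecutive power sums ending at multiples of i₀·N (shifted by s - 1) agree;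
-- running back to 0 gives P (π·i₀·N) ≡ s ≢ 0 (mod M) for some π ≥ 1. Then k = π·i₀ works, in degree π·d·N.

module Submission where

open import Defs
open import Data.Nat using (ℕ; zero; suc; _≤_; _<_; _*_; _+_; _∸_; _^_; z≤n; s≤s; NonZero; ≢-nonZero; >-nonZero⁻¹)
import Data.Nat.Properties as ℕ
open import Data.Nat.Divisibility using (∣⇒≤) renaming (divides to dividesℕ; _∣?_ to _∣ℕ?_)
open import Data.Nat.ListAction using (sum)
open import Data.Nat.Tactic.RingSolver using () renaming (solve-∀ to ℕ-solve-∀)
open import Data.Integer using (ℤ; +_; -[1+_]; 0ℤ; 1ℤ; ∣_∣)
  renaming (_+_ to _+ℤ_; _*_ to _*ℤ_; -_ to -ℤ_; _-_ to _-ℤ_; _≤_ to _≤ℤ_)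
import Data.Integer.Properties as ℤ
open import Data.Integer.DivMod using (_%ℕ_; _/ℕ_; n%ℕd<d; a≡a%ℕn+[a/ℕn]*n)
open import Data.Integer.Divisibility.Signed
  using (_∣_; divides; ∣⇒∣ᵤ; ∣m∣n⇒∣m+n; ∣m∣n⇒∣m-n; ∣m⇒∣-m; ∣n⇒∣m*n)
open import Data.Integer.Tactic.RingSolver using (solve-∀)
open import Data.Rational.Unnormalised using (ℚᵘ; mkℚᵘ; *≤*) renaming (_≤_ to _≤ℚ_)
import Data.Rational.Unnormalised.Properties as ℚᵘ
open import Data.Fin using (Fin; toℕ; fromℕ<; funToFin; finToFun)
import Data.Fin.Properties as Fin
open import Data.List using (List; []; _∷_; map; length; filter; upTo; cartesianProduct)
open import Data.List.Extrema ℚᵘ.≤-totalOrder using (argmax; argmax-all; f[xs]≤f[argmax])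
import Data.List.Relation.Unary.All as All
open import Data.List.Relation.Unary.All.Properties using (all-filter)
open import Data.List.Relation.Unary.Any using (Any; here; there)
import Data.List.Relation.Unary.Any.Properties as Any
open import Data.List.Membership.Propositional using (lose)
open import Data.List.Membership.Propositional.Properties using (∈-filter⁺; ∈-cartesianProduct⁺; ∈-upTo⁺; ∈-allFin)
open import Data.Product using (∃; _×_; _,_; proj₁; proj₂)
open import Data.Sum using (_⊎_; inj₁; inj₂)
open import Function using (_∘_)
open import Relation.Binary using (tri<; tri≈; tri>)
open import Relation.Binary.PropositionalEquality
open import Relation.Nullary using (¬_; ¬?; Dec; yes; no; contradiction)
open import Relation.Nullary.Decidable using (map′)

∑ : ℕ → (ℕ → ℤ) → ℤ
∑ zero    f = 0ℤ
∑ (suc K) f = ∑ K f +ℤ f K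

infix 5 ∑
syntax ∑ K (λ t → x) = ∑[ t < K ] x

∑-cong : ∀ K {f g} → (∀ t → t < K → f t ≡ g t) → ∑ K f ≡ ∑ K g
∑-cong zero    f≗g = refl
∑-cong (suc K) f≗g = cong₂ _+ℤ_ (∑-cong K (λ t t<K → f≗g t (ℕ.m<n⇒m<1+n t<K))) (f≗g K ℕ.≤-refl)

∑-truncate : ∀ {s K f} → s ≤ K → (∀ t → s ≤ t → t < K → f t ≡ 0ℤ) → ∑ K f ≡ ∑ s f
∑-truncate {s} {K} {f} s≤K tail≡0 with ℕ.m≤n⇒m<n∨m≡n s≤K
... | inj₂ refl = refl
... | inj₁ s<K@(s≤s {n = K′} s≤K′) = begin
  ∑ K′ f +ℤ f K′ ≡⟨ cong₂ _+ℤ_ (∑-truncate s≤K′ tail′≡0) (tail≡0 K′ s≤K′ ℕ.≤-refl) ⟩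
  ∑ s f +ℤ 0ℤ    ≡⟨ ℤ.+-identityʳ _ ⟩
  ∑ s f          ∎
  where
  open ≡-Reasoning
  tail′≡0 : ∀ t → s ≤ t → t < K′ → f t ≡ 0ℤ
  tail′≡0 t s≤t t<K′ = tail≡0 t s≤t (ℕ.m<n⇒m<1+n t<K′)

∑-zero : ∀ K {f} → (∀ t → t < K → f t ≡ 0ℤ) → ∑ K f ≡ 0ℤ
∑-zero K f≡0 = ∑-truncate z≤n (λ t _ → f≡0 t)

∑-single : ∀ K {f} u → u < K → (∀ t → t < K → t ≢ u → f t ≡ 0ℤ) → ∑ K f ≡ f u
∑-single (suc K) {f} u u<1+K others with ℕ.m≤n⇒m<n∨m≡n (ℕ.≤-pred u<1+K)
... | inj₁ u<K = begin
  ∑ K f +ℤ f K ≡⟨ cong₂ _+ℤ_ (∑-single K u u<K (λ t t<K → others t (ℕ.m<n⇒m<1+n t<K)))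
                             (others K ℕ.≤-refl (λ K≡u → ℕ.<-irrefl (sym K≡u) u<K)) ⟩
  f u +ℤ 0ℤ    ≡⟨ ℤ.+-identityʳ _ ⟩
  f u          ∎
  where open ≡-Reasoning
... | inj₂ refl = begin
  ∑ K f +ℤ f K ≡⟨ cong (_+ℤ f K) (∑-zero K (λ t t<K → others t (ℕ.m<n⇒m<1+n t<K) (ℕ.<⇒≢ t<K))) ⟩
  0ℤ +ℤ f K    ≡⟨ ℤ.+-identityˡ _ ⟩
  f K          ∎
  where open ≡-Reasoning

∑-suc : ∀ K f → ∑ (suc K) f ≡ f 0 +ℤ (∑[ t < K ] f (suc t))
∑-suc zero    f = trans (ℤ.+-identityˡ (f 0)) (sym (ℤ.+-identityʳ (f 0)))
∑-suc (suc K) f = trans (cong (_+ℤ f (suc K)) (∑-suc K f)) (ℤ.+-assoc (f 0) _ _)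

coeff-+ : ∀ p q e → coeff (p +ᴾ q) e ≡ coeff p e +ℤ coeff q e
coeff-+ []      q       e       = sym (ℤ.+-identityˡ _)
coeff-+ (a ∷ p) []      zero    = sym (ℤ.+-identityʳ _)
coeff-+ (a ∷ p) []      (suc e) = sym (ℤ.+-identityʳ _)
coeff-+ (a ∷ p) (b ∷ q) zero    = refl
coeff-+ (a ∷ p) (b ∷ q) (suc e) = coeff-+ p q e

coeff-map : ∀ {f} → f 0ℤ ≡ 0ℤ → ∀ p e → coeff (map f p) e ≡ f (coeff p e)
coeff-map f0≡0 []      e       = sym f0≡0
coeff-map f0≡0 (a ∷ p) zero    = refl
coeff-map f0≡0 (a ∷ p) (suc e) = coeff-map f0≡0 p e

coeff-· : ∀ k p e → coeff (k ·ᴾ p) e ≡ k *ℤ coeff p e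
coeff-· k = coeff-map (ℤ.*-zeroʳ k)

coeff-* : ∀ p q e → coeff (p *ᴾ q) e ≡ ∑[ u < suc e ] coeff p u *ℤ coeff q (e ∸ u)
coeff-* []      q e = sym (∑-zero (suc e) (λ _ _ → refl))
coeff-* (a ∷ p) q e = begin
  coeff (a ·ᴾ q +ᴾ (0ℤ ∷ p *ᴾ q)) e
    ≡⟨ coeff-+ (a ·ᴾ q) _ e ⟩
  coeff (a ·ᴾ q) e +ℤ coeff (0ℤ ∷ p *ᴾ q) e
    ≡⟨ cong₂ _+ℤ_ (coeff-· a q e) (shifted e) ⟩
  a *ℤ coeff q e +ℤ (∑[ u < e ] coeff p u *ℤ coeff q (e ∸ suc u))
    ≡⟨ ∑-suc e _ ⟨
  ∑[ u < suc e ] coeff (a ∷ p) u *ℤ coeff q (e ∸ u) ∎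
  where
  open ≡-Reasoning
  shifted : ∀ e → coeff (0ℤ ∷ p *ᴾ q) e ≡ ∑[ u < e ] coeff p u *ℤ coeff q (e ∸ suc u)
  shifted zero    = refl
  shifted (suc e) = coeff-* p q e

-- The monomial x^e has weight i₀·e, and level α stands for the weight d·α.
module Weighted (i₀ d : ℕ) .{{_ : NonZero i₀}} where

  OnLattice : ℕ → Set
  OnLattice m = ∃ λ e → i₀ * e ≡ m

  onLattice? : ∀ m → Dec (OnLattice m)
  onLattice? m = map′ (λ (dividesℕ e m≡e*i₀) → e , trans (ℕ.*-comm i₀ e) (sym m≡e*i₀))
                      (λ (e , i₀*e≡m) → dividesℕ e (trans (sym i₀*e≡m) (ℕ.*-comm i₀ e)))
                      (i₀ ∣ℕ? m)

  Bounded : Poly → ℕ → Set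
  Bounded A α = ∀ e → d * α < i₀ * e → coeff A e ≡ 0ℤ

  record Leading (A : Poly) (α : ℕ) (ℓ : ℤ) : Set where
    field
      bounded : Bounded A α
      at      : ∀ e → i₀ * e ≡ d * α → coeff A e ≡ ℓ
      off     : ¬ OnLattice (d * α) → ℓ ≡ 0ℤ

  Leading-0ᴾ : ∀ {α} → Leading 0ᴾ α 0ℤ
  Leading-0ᴾ = record { bounded = λ _ _ → refl ; at = λ _ _ → refl ; off = λ _ → refl }

  Leading-+ : ∀ {A B α a b} → Leading A α a → Leading B α b → Leading (A +ᴾ B) α (a +ℤ b)
  Leading-+ {A} {B} LA LB = record
    { bounded = λ e lt → trans (coeff-+ A B e) (cong₂ _+ℤ_ (LA.bounded e lt) (LB.bounded e lt))
    ; at      = λ e eq → trans (coeff-+ A B e) (cong₂ _+ℤ_ (LA.at e eq) (LB.at e eq))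
    ; off     = λ ¬lat → cong₂ _+ℤ_ (LA.off ¬lat) (LB.off ¬lat)
    }
    where
    module LA = Leading LA
    module LB = Leading LB

  Leading-map : ∀ {f A α a} → f 0ℤ ≡ 0ℤ → Leading A α a → Leading (map f A) α (f a)
  Leading-map {f} {A} f0≡0 LA = record
    { bounded = λ e lt → trans (coeff-map f0≡0 A e) (trans (cong f (LA.bounded e lt)) f0≡0)
    ; at      = λ e eq → trans (coeff-map f0≡0 A e) (cong f (LA.at e eq))
    ; off     = λ ¬lat → trans (cong f (LA.off ¬lat)) f0≡0
    }
    where module LA = Leading LA

  module Product {A B α β a b} (LA : Leading A α a) (LB : Leading B β b) where
    open Leading LA renaming (bounded to A-bounded; at to A-at; off to A-off)
    open Leading LB renaming (bounded to B-bounded; at to B-at; off to B-off)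
    open ≡-Reasoning

    term : ℕ → ℕ → ℤ
    term e u = coeff A u *ℤ coeff B (e ∸ u)

    vanish : ∀ e u → d * α < i₀ * u ⊎ d * β + i₀ * u < i₀ * e → term e u ≡ 0ℤ
    vanish e u (inj₁ dα<) = cong (_*ℤ coeff B (e ∸ u)) (A-bounded u dα<)
    vanish e u (inj₂ lt)  = trans (cong (coeff A u *ℤ_) (B-bounded (e ∸ u) dβ<)) (ℤ.*-zeroʳ (coeff A u))
      where
      dβ< : d * β < i₀ * (e ∸ u)
      dβ< = subst (d * β <_) (sym (ℕ.*-distribˡ-∸ i₀ e u)) (ℕ.m+n≤o⇒m≤o∸n (suc (d * β)) lt)

    vanish-off-level : ∀ e u → d * α + d * β ≡ i₀ * e → i₀ * u ≢ d * α → term e u ≡ 0ℤ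
    vanish-off-level e u level ne with ℕ.<-cmp (i₀ * u) (d * α)
    ... | tri< lt _ _ = vanish e u (inj₂ (subst (d * β + i₀ * u <_)
                          (trans (ℕ.+-comm (d * β) (d * α)) level) (ℕ.+-monoʳ-< (d * β) lt)))
    ... | tri≈ _ eq _ = contradiction eq ne
    ... | tri> _ _ gt = vanish e u (inj₁ gt)

    bounded : Bounded (A *ᴾ B) (α + β)
    bounded e lt = trans (coeff-* A B e) (∑-zero (suc e) λ u _ → vanish e u (below u))
      where
      below : ∀ u → d * α < i₀ * u ⊎ d * β + i₀ * u < i₀ * e
      below u with d * α ℕ.<? i₀ * u
      ... | yes dα< = inj₁ dα<
      ... | no  dα≮ = inj₂ (ℕ.≤-<-trans
                        (subst (d * β + i₀ * u ≤_) (ℕ.+-comm (d * β) (d * α)) (ℕ.+-monoʳ-≤ (d * β) (ℕ.≮⇒≥ dα≮)))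
                        (subst (_< i₀ * e) (ℕ.*-distribˡ-+ d α β) lt))

    at : ∀ e → i₀ * e ≡ d * (α + β) → coeff (A *ᴾ B) e ≡ a *ℤ b
    at e eq with onLattice? (d * α)
    ... | no ¬lat = begin
      coeff (A *ᴾ B) e          ≡⟨ coeff-* A B e ⟩
      (∑[ u < suc e ] term e u) ≡⟨ ∑-zero (suc e) (λ u _ → vanish-off-level e u level (¬lat ∘ (u ,_))) ⟩
      0ℤ                        ≡⟨ cong (_*ℤ b) (A-off ¬lat) ⟨
      a *ℤ b                    ∎
      where level = trans (sym (ℕ.*-distribˡ-+ d α β)) (sym eq)
    ... | yes (q , i₀q≡dα) = begin
      coeff (A *ᴾ B) e          ≡⟨ coeff-* A B e ⟩
      (∑[ u < suc e ] term e u) ≡⟨ ∑-single (suc e) q q≤e others ⟩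
      term e q                  ≡⟨ cong₂ _*ℤ_ (A-at q i₀q≡dα) (B-at (e ∸ q) i₀[e∸q]≡dβ) ⟩
      a *ℤ b                    ∎
      where
      level = trans (sym (ℕ.*-distribˡ-+ d α β)) (sym eq)
      q≤e : q < suc e
      q≤e = s≤s (ℕ.*-cancelˡ-≤ i₀ (subst₂ _≤_ (sym i₀q≡dα) level (ℕ.m≤m+n (d * α) (d * β))))
      others : ∀ u → u < suc e → u ≢ q → term e u ≡ 0ℤ
      others u _ u≢q = vanish-off-level e u level
                         (λ i₀u≡dα → u≢q (ℕ.*-cancelˡ-≡ u q i₀ (trans i₀u≡dα (sym i₀q≡dα))))
      i₀[e∸q]≡dβ : i₀ * (e ∸ q) ≡ d * β
      i₀[e∸q]≡dβ = begin
        i₀ * (e ∸ q)          ≡⟨ ℕ.*-distribˡ-∸ i₀ e q ⟩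
        i₀ * e ∸ i₀ * q       ≡⟨ cong₂ _∸_ (sym level) i₀q≡dα ⟩
        d * α + d * β ∸ d * α ≡⟨ ℕ.m+n∸m≡n (d * α) (d * β) ⟩
        d * β                 ∎

    off : ¬ OnLattice (d * (α + β)) → a *ℤ b ≡ 0ℤ
    off ¬lat with onLattice? (d * α)
    ... | no ¬latA         = cong (_*ℤ b) (A-off ¬latA)
    ... | yes (q , i₀q≡dα) = trans (cong (a *ℤ_) (B-off ¬latB)) (ℤ.*-zeroʳ a)
      where
      ¬latB : ¬ OnLattice (d * β)
      ¬latB (e , i₀e≡dβ) = ¬lat (q + e , trans (ℕ.*-distribˡ-+ i₀ q e)
                                        (trans (cong₂ _+_ i₀q≡dα i₀e≡dβ) (sym (ℕ.*-distribˡ-+ d α β))))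

  Leading-* : ∀ {A B α β a b} → Leading A α a → Leading B β b → Leading (A *ᴾ B) (α + β) (a *ℤ b)
  Leading-* LA LB = record { bounded = bounded ; at = at ; off = off }
    where open Product LA LB

  top : Poly → ℕ → ℤ
  top A α with onLattice? (d * α)
  ... | yes (e , _) = coeff A e
  ... | no _        = 0ℤ

  Leading-top : ∀ {A α} → Bounded A α → Leading A α (top A α)
  Leading-top {A} {α} bnd = record { bounded = bnd ; at = at ; off = off }
    where
    at : ∀ e → i₀ * e ≡ d * α → coeff A e ≡ top A α
    at e i₀e≡dα with onLattice? (d * α)
    ... | yes (e′ , i₀e′≡dα) = cong (coeff A) (ℕ.*-cancelˡ-≡ e e′ i₀ (trans i₀e≡dα (sym i₀e′≡dα)))
    ... | no ¬lat            = contradiction (e , i₀e≡dα) ¬lat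
    off : ¬ OnLattice (d * α) → top A α ≡ 0ℤ
    off ¬lat with onLattice? (d * α)
    ... | yes lat = contradiction lat ¬lat
    ... | no _    = refl

  top-0ᴾ : ∀ α → top 0ᴾ α ≡ 0ℤ
  top-0ᴾ α with onLattice? (d * α)
  ... | yes _ = refl
  ... | no _  = refl

  data Leadings : ℕ → List Poly → List ℤ → Set where
    []  : Leadings 0 [] []
    _∷_ : ∀ {m x xs y ys} → Leading x (suc m) y → Leadings m xs ys → Leadings (suc m) (x ∷ xs) (y ∷ ys)

  Leading-head : ∀ {m xs ys} → Leadings m xs ys → Leading (nth xs 0ᴾ 0) m (nth ys 0ℤ 0)
  Leading-head []      = Leading-0ᴾ
  Leading-head (l ∷ _) = l

-- Defs.PowerSums over ℤ, with the integers h i in place of the polynomials c i.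
module PowerSumsℤ (h : ℕ → ℤ) where

  dot : ℕ → List ℤ → ℤ
  dot i []       = 0ℤ
  dot i (x ∷ xs) = h (suc i) *ℤ x +ℤ dot (suc i) xs

  psRev : ℕ → List ℤ
  psRev zero    = []
  psRev (suc m) = -ℤ (dot 0 (psRev m) +ℤ (+ suc m) *ℤ h (suc m)) ∷ psRev m

  P : ℕ → ℤ
  P m = nth (psRev m) 0ℤ 0

module _ (n : ℕ) (a : Fin n → Poly) (i₀ d : ℕ) .{{_ : NonZero i₀}} (h : ℕ → ℤ) where
  open PowerSums n a
  open PowerSumsℤ h using (P) renaming (dot to dotℤ; psRev to psRevℤ)
  open Weighted i₀ d

  Leading-Q : (∀ i → Leading (c i) i (h i)) → ∀ m → Leading (Q m n a) m (P m)
  Leading-Q leading-c m = Leading-head (Leading-psRev m)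
    where
    Leading-dot : ∀ i {m xs ys} → Leadings m xs ys → Leading (dot i xs) (suc i + m) (dotℤ i ys)
    Leading-dot i []                                    = Leading-0ᴾ
    Leading-dot i {suc m} {_ ∷ xs} {_ ∷ ys} (lx ∷ rest) =
      Leading-+ (Leading-* (leading-c (suc i)) lx)
                (subst (λ α → Leading (dot (suc i) xs) α (dotℤ (suc i) ys)) (sym (ℕ.+-suc (suc i) m))
                       (Leading-dot (suc i) rest))

    Leading-psRev : ∀ m → Leadings m (psRev m) (psRevℤ m)
    Leading-psRev zero    = []
    Leading-psRev (suc m) =
      Leading-map refl (Leading-+ (Leading-dot 0 (Leading-psRev m))
                                  (Leading-map (ℤ.*-zeroʳ (+ suc m)) (leading-c (suc m))))
      ∷ Leading-psRev m

module Modulo (M : ℕ) .{{_ : NonZero M}} where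

  infix 4 _≡ₘ_
  record _≡ₘ_ (x y : ℤ) : Set where
    constructor mod-M
    field M∣x-y : + M ∣ x -ℤ y

  ≡ₘ-refl : ∀ x → x ≡ₘ x
  ≡ₘ-refl x = mod-M (divides 0ℤ (ℤ.+-inverseʳ x))

  ≡ₘ-+ : ∀ {x y u v} → x ≡ₘ y → u ≡ₘ v → x +ℤ u ≡ₘ y +ℤ v
  ≡ₘ-+ {x} {y} {u} {v} (mod-M M∣x-y) (mod-M M∣u-v) =
    mod-M (subst (+ M ∣_) (regroup x y u v) (∣m∣n⇒∣m+n M∣x-y M∣u-v))
    where
    regroup : ∀ x y u v → (x -ℤ y) +ℤ (u -ℤ v) ≡ (x +ℤ u) -ℤ (y +ℤ v)
    regroup = solve-∀

  ≡ₘ-neg : ∀ {x y} → x ≡ₘ y → -ℤ x ≡ₘ -ℤ y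
  ≡ₘ-neg {x} {y} (mod-M M∣x-y) = mod-M (subst (+ M ∣_) (regroup x y) (∣m⇒∣-m M∣x-y))
    where
    regroup : ∀ x y → -ℤ (x -ℤ y) ≡ (-ℤ x) -ℤ (-ℤ y)
    regroup = solve-∀

  ≡ₘ-*ˡ : ∀ k {x y} → x ≡ₘ y → k *ℤ x ≡ₘ k *ℤ y
  ≡ₘ-*ˡ k {x} {y} (mod-M M∣x-y) = mod-M (subst (+ M ∣_) (regroup k x y) (∣n⇒∣m*n k M∣x-y))
    where
    regroup : ∀ k x y → k *ℤ (x -ℤ y) ≡ k *ℤ x -ℤ k *ℤ y
    regroup = solve-∀

  ≡ₘ-∑ : ∀ K {f g} → (∀ t → t < K → f t ≡ₘ g t) → ∑ K f ≡ₘ ∑ K g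
  ≡ₘ-∑ zero    f≡g = ≡ₘ-refl 0ℤ
  ≡ₘ-∑ (suc K) f≡g = ≡ₘ-+ (≡ₘ-∑ K (λ t t<K → f≡g t (ℕ.m<n⇒m<1+n t<K))) (f≡g K ℕ.≤-refl)

  ≡ₘ-cancel : ∀ k u {x y} → u *ℤ k ≡ₘ 1ℤ → k *ℤ x ≡ₘ k *ℤ y → x ≡ₘ y
  ≡ₘ-cancel k u {x} {y} (mod-M M∣uk-1) (mod-M M∣kx-ky) =
    mod-M (subst (+ M ∣_) (regroup k u x y) (∣m∣n⇒∣m-n (∣n⇒∣m*n u M∣kx-ky) (∣n⇒∣m*n (x -ℤ y) M∣uk-1)))
    where
    regroup : ∀ k u x y → u *ℤ (k *ℤ x -ℤ k *ℤ y) -ℤ (x -ℤ y) *ℤ (u *ℤ k -ℤ 1ℤ) ≡ x -ℤ y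
    regroup = solve-∀

  ≢ₘ0 : ∀ {s} → 0 < s → s < M → ¬ (+ s ≡ₘ 0ℤ)
  ≢ₘ0 {suc s} _ s<M (mod-M M∣s) = ℕ.<⇒≱ s<M (subst (M ≤_) (ℕ.+-identityʳ (suc s)) (∣⇒≤ (∣⇒∣ᵤ M∣s)))

  residue : ℤ → Fin M
  residue x = fromℕ< (n%ℕd<d x M)

  residue-≡⇒≡ₘ : ∀ x y → residue x ≡ residue y → x ≡ₘ y
  residue-≡⇒≡ₘ x y eq = mod-M (divides (x /ℕ M -ℤ y /ℕ M) (begin
    x -ℤ y
      ≡⟨ cong₂ _-ℤ_ (a≡a%ℕn+[a/ℕn]*n x M) (a≡a%ℕn+[a/ℕn]*n y M) ⟩
    (+ (x %ℕ M) +ℤ x /ℕ M *ℤ + M) -ℤ (+ (y %ℕ M) +ℤ y /ℕ M *ℤ + M)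
      ≡⟨ cong (λ k → (+ k +ℤ x /ℕ M *ℤ + M) -ℤ (+ (y %ℕ M) +ℤ y /ℕ M *ℤ + M)) same-remainder ⟩
    (+ (y %ℕ M) +ℤ x /ℕ M *ℤ + M) -ℤ (+ (y %ℕ M) +ℤ y /ℕ M *ℤ + M)
      ≡⟨ regroup (+ (y %ℕ M)) (x /ℕ M) (y /ℕ M) (+ M) ⟩
    (x /ℕ M -ℤ y /ℕ M) *ℤ + M ∎))
    where
    open ≡-Reasoning
    same-remainder : x %ℕ M ≡ y %ℕ M
    same-remainder = trans (sym (Fin.toℕ-fromℕ< _)) (trans (cong toℕ eq) (Fin.toℕ-fromℕ< _))
    regroup : ∀ k p q m → (k +ℤ p *ℤ m) -ℤ (k +ℤ q *ℤ m) ≡ (p -ℤ q) *ℤ m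
    regroup = solve-∀

module NonzeroRoots (h : ℕ → ℤ) (r : ℕ) (h-top≢0 : h (suc r) ≢ 0ℤ)
                            (h-vanishes : ∀ i → suc r < i → h i ≡ 0ℤ) where
  open PowerSumsℤ h

  -- The power sums of the suc r nonzero roots. Unlike P 0 = 0, ℓ 0 counts the roots, which turns
  -- Newton's identities into a linear recurrence of order suc r, valid from m = r on.
  ℓ : ℕ → ℤ
  ℓ zero    = + suc r
  ℓ (suc m) = P (suc m)

  ℓ-pos : ∀ m → 0 < m → ℓ m ≡ P m
  ℓ-pos (suc m) _ = refl

  dot-∑ : ∀ i m → dot i (psRev m) ≡ ∑[ t < m ] h (suc i + t) *ℤ P (m ∸ t)
  dot-∑ i zero    = refl
  dot-∑ i (suc m) = begin
    h (suc i) *ℤ P (suc m) +ℤ dot (suc i) (psRev m)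
      ≡⟨ cong₂ _+ℤ_ (cong (λ j → h j *ℤ P (suc m)) (sym (ℕ.+-identityʳ (suc i))))
                    (trans (dot-∑ (suc i) m)
                           (∑-cong m λ t _ → cong (λ j → h j *ℤ P (m ∸ t)) (sym (ℕ.+-suc (suc i) t)))) ⟩
    h (suc i + 0) *ℤ P (suc m) +ℤ (∑[ t < m ] h (suc i + suc t) *ℤ P (m ∸ t))
      ≡⟨ ∑-suc m _ ⟨
    (∑[ t < suc m ] h (suc i + t) *ℤ P (suc m ∸ t)) ∎
    where open ≡-Reasoning

  recurrence : ∀ {m} → r ≤ m → ℓ (suc m) +ℤ (∑[ t < suc r ] h (suc t) *ℤ ℓ (m ∸ t)) ≡ 0ℤ
  recurrence {m} r≤m = begin
    ℓ (suc m) +ℤ (∑[ t < suc r ] h (suc t) *ℤ ℓ (m ∸ t))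
      ≡⟨ cong (ℓ (suc m) +ℤ_) (∑-truncate (s≤s r≤m) beyond-r) ⟨
    ℓ (suc m) +ℤ (∑[ t < suc m ] h (suc t) *ℤ ℓ (m ∸ t))
      ≡⟨ cong (ℓ (suc m) +ℤ_) (cong₂ _+ℤ_ (trans (∑-cong m earlier) (sym (dot-∑ 0 m))) last) ⟩
    -ℤ X +ℤ X
      ≡⟨ ℤ.+-inverseˡ X ⟩
    0ℤ ∎
    where
    open ≡-Reasoning
    X = dot 0 (psRev m) +ℤ (+ suc m) *ℤ h (suc m)
    beyond-r : ∀ t → suc r ≤ t → t < suc m → h (suc t) *ℤ ℓ (m ∸ t) ≡ 0ℤ
    beyond-r t r<t _ = cong (_*ℤ ℓ (m ∸ t)) (h-vanishes (suc t) (s≤s r<t))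
    earlier : ∀ t → t < m → h (suc t) *ℤ ℓ (m ∸ t) ≡ h (suc t) *ℤ P (m ∸ t)
    earlier t t<m = cong (h (suc t) *ℤ_) (ℓ-pos (m ∸ t) (ℕ.m<n⇒0<n∸m t<m))
    last : h (suc m) *ℤ ℓ (m ∸ m) ≡ (+ suc m) *ℤ h (suc m)
    last with ℕ.m≤n⇒m<n∨m≡n r≤m
    ... | inj₁ r<m  = trans (cong (_*ℤ ℓ (m ∸ m)) h≡0)
                            (sym (trans (cong ((+ suc m) *ℤ_) h≡0) (ℤ.*-zeroʳ (+ suc m))))
      where h≡0 = h-vanishes (suc m) (s≤s r<m)
    ... | inj₂ refl = trans (cong (λ k → h (suc r) *ℤ ℓ k) (ℕ.n∸n≡0 r)) (ℤ.*-comm (h (suc r)) (+ suc r))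

  H : ℕ
  H = ∣ h (suc r) ∣ * ∣ h (suc r) ∣

  -- Makes h (suc r) a unit modulo M, with inverse -(suc r)·h (suc r), while keeping suc r < M.
  M : ℕ
  M = suc (suc r * H)

  open Modulo M

  h⁻¹ : ℤ
  h⁻¹ = -ℤ (+ suc r *ℤ h (suc r))

  h-invertible : h⁻¹ *ℤ h (suc r) ≡ₘ 1ℤ
  h-invertible = mod-M (divides (-ℤ 1ℤ) (begin
    (-ℤ (+ suc r *ℤ hₛ)) *ℤ hₛ -ℤ 1ℤ       ≡⟨ regroup (+ suc r) hₛ ⟩
    -ℤ 1ℤ *ℤ (1ℤ +ℤ + suc r *ℤ (hₛ *ℤ hₛ)) ≡⟨ cong (λ m → -ℤ 1ℤ *ℤ (1ℤ +ℤ m)) +[r+1]*H≡ ⟨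
    -ℤ 1ℤ *ℤ + M                           ∎))
    where
    open ≡-Reasoning
    hₛ = h (suc r)
    square : ∀ i → + (∣ i ∣ * ∣ i ∣) ≡ i *ℤ i
    square (+ n)    = ℤ.pos-* n n
    square -[1+ n ] = refl
    regroup : ∀ s h → (-ℤ (s *ℤ h)) *ℤ h -ℤ 1ℤ ≡ -ℤ 1ℤ *ℤ (1ℤ +ℤ s *ℤ (h *ℤ h))
    regroup = solve-∀
    +[r+1]*H≡ : + (suc r * H) ≡ + suc r *ℤ (hₛ *ℤ hₛ)
    +[r+1]*H≡ = trans (ℤ.pos-* (suc r) H) (cong (+ suc r *ℤ_) (square hₛ))

  suc-r<M : suc r < M
  suc-r<M = s≤s (ℕ.m≤m*n (suc r) H {{ℕ.m*n≢0 _ _ {{∣h∣≢0}} {{∣h∣≢0}}}})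
    where
    ∣h∣≢0 : NonZero ∣ h (suc r) ∣
    ∣h∣≢0 = ≢-nonZero (λ ∣h∣≡0 → h-top≢0 (ℤ.∣i∣≡0⇒i≡0 ∣h∣≡0))

  Agree : ℕ → ℕ → Set
  Agree a b = ∀ t → t ≤ r → ℓ (a ∸ t) ≡ₘ ℓ (b ∸ t)

  recurrence-solved : ∀ {m} → r ≤ m →
                      h (suc r) *ℤ ℓ (m ∸ r) ≡ -ℤ (ℓ (suc m) +ℤ (∑[ t < r ] h (suc t) *ℤ ℓ (m ∸ t)))
  recurrence-solved {m} r≤m = isolate (ℓ (suc m)) (∑[ t < r ] h (suc t) *ℤ ℓ (m ∸ t)) (recurrence r≤m)
    where
    isolate : ∀ x y {z} → x +ℤ (y +ℤ z) ≡ 0ℤ → z ≡ -ℤ (x +ℤ y)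
    isolate x y {z} eq = trans (regroup x y z) (trans (cong (_-ℤ (x +ℤ y)) eq) (ℤ.+-identityˡ _))
      where
      regroup : ∀ x y z → z ≡ (x +ℤ (y +ℤ z)) -ℤ (x +ℤ y)
      regroup = solve-∀

  Agree-pred : ∀ {a b} → r ≤ a → r ≤ b → Agree (suc a) (suc b) → Agree a b
  Agree-pred {a} {b} r≤a r≤b agree t t≤r with ℕ.m≤n⇒m<n∨m≡n t≤r
  ... | inj₁ t<r  = agree (suc t) t<r
  ... | inj₂ refl = ≡ₘ-cancel (h (suc r)) h⁻¹ h-invertible
    (subst₂ _≡ₘ_ (sym (recurrence-solved r≤a)) (sym (recurrence-solved r≤b))
      (≡ₘ-neg (≡ₘ-+ (agree 0 z≤n) (≡ₘ-∑ r λ t t<r → ≡ₘ-*ˡ (h (suc t)) (agree (suc t) t<r)))))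

  Agree-cancel : ∀ x {a b} → r ≤ a → r ≤ b → Agree (x + a) (x + b) → Agree a b
  Agree-cancel zero    r≤a r≤b agree = agree
  Agree-cancel (suc x) {a} {b} r≤a r≤b agree = Agree-cancel x r≤a r≤b
    (Agree-pred (ℕ.≤-trans r≤a (ℕ.m≤n+m a x)) (ℕ.≤-trans r≤b (ℕ.m≤n+m b x)) agree)

  window : ℕ → Fin (M ^ suc r)
  window a = funToFin {suc r} (λ t → residue (ℓ (a ∸ toℕ t)))

  window-≡⇒Agree : ∀ a b → window a ≡ window b → Agree a b
  window-≡⇒Agree a b eq t t≤r =
    subst (λ k → ℓ (a ∸ k) ≡ₘ ℓ (b ∸ k)) (Fin.toℕ-fromℕ< (s≤s t≤r)) (residue-≡⇒≡ₘ _ _ (begin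
      residue (ℓ (a ∸ toℕ t′)) ≡⟨ Fin.finToFun-funToFin {suc r} (λ t → residue (ℓ (a ∸ toℕ t))) t′ ⟨
      finToFun (window a) t′   ≡⟨ cong (λ w → finToFun {M} {suc r} w t′) eq ⟩
      finToFun (window b) t′   ≡⟨ Fin.finToFun-funToFin {suc r} (λ t → residue (ℓ (b ∸ toℕ t))) t′ ⟩
      residue (ℓ (b ∸ toℕ t′)) ∎))
    where
    open ≡-Reasoning
    t′ : Fin (suc r)
    t′ = fromℕ< (s≤s t≤r)

  P-nonvanishing-on-multiples : ∀ N → 1 ≤ N → ∃ λ π → 1 ≤ π × P (π * N) ≢ 0ℤ
  P-nonvanishing-on-multiples N N≥1 with Fin.pigeonhole (ℕ.n<1+n (M ^ suc r)) (λ j → window (toℕ j * N + r))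
  ... | i , j , i<j , same-window = δ , δ≥1 , P[δN]≢0
    where
    δ = toℕ j ∸ toℕ i
    δ≥1 : 1 ≤ δ
    δ≥1 = ℕ.m<n⇒0<n∸m i<j

    shift : toℕ j * N + r ≡ toℕ i * N + (δ * N + r)
    shift = trans (cong (λ k → k * N + r) (sym (ℕ.m+[n∸m]≡n (ℕ.<⇒≤ i<j)))) (regroup (toℕ i) δ N r)
      where
      regroup : ∀ a b n r → (a + b) * n + r ≡ a * n + (b * n + r)
      regroup = ℕ-solve-∀

    agree : Agree r (δ * N + r)
    agree = Agree-cancel (toℕ i * N) ℕ.≤-refl (ℕ.m≤n+m r (δ * N))
              (subst (Agree (toℕ i * N + r)) shift (window-≡⇒Agree _ _ same-window))

    suc-r≡ₘP[δN] : + suc r ≡ₘ P (δ * N)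
    suc-r≡ₘP[δN] = subst₂ _≡ₘ_ (cong ℓ (ℕ.n∸n≡0 r))
                     (trans (cong ℓ (ℕ.m+n∸n≡m (δ * N) r)) (ℓ-pos (δ * N) (ℕ.*-mono-≤ δ≥1 N≥1)))
                     (agree r ℕ.≤-refl)

    P[δN]≢0 : P (δ * N) ≢ 0ℤ
    P[δN]≢0 P≡0 = ≢ₘ0 (s≤s z≤n) suc-r<M (subst (+ suc r ≡ₘ_) P≡0 suc-r≡ₘP[δN])

coeff≢0⇒<length : ∀ A e → coeff A e ≢ 0ℤ → e < length A
coeff≢0⇒<length []      e       ne = contradiction refl ne
coeff≢0⇒<length (a ∷ A) zero    ne = s≤s z≤n
coeff≢0⇒<length (a ∷ A) (suc e) ne = s≤s (coeff≢0⇒<length A e ne)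

nth-coeff≢0⇒bounded : ∀ As t e → coeff (nth As 0ᴾ t) e ≢ 0ℤ → t < length As × e < sum (map length As)
nth-coeff≢0⇒bounded []       t       e ne = contradiction refl ne
nth-coeff≢0⇒bounded (A ∷ As) zero    e ne = s≤s z≤n , ℕ.≤-trans (coeff≢0⇒<length A e ne) (ℕ.m≤m+n _ _)
nth-coeff≢0⇒bounded (A ∷ As) (suc t) e ne with nth-coeff≢0⇒bounded As t e ne
... | t<length , e<sum = s≤s t<length , ℕ.≤-trans e<sum (ℕ.m≤n+m _ (length A))

Any-nth : ∀ {A : Set} {P : A → Set} {xs d} → Any P xs → ∃ λ t → P (nth xs d t)
Any-nth (here px)   = 0 , px
Any-nth (there pxs) with Any-nth pxs
... | t , pxt = suc t , pxt

coeff≢0⇒Nonconstant : ∀ A e → 0 < e → coeff A e ≢ 0ℤ → Nonconstant A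
coeff≢0⇒Nonconstant A (suc e) _ ne = e , ne

last-nonzero : ∀ (f : ℕ → ℤ) B {j} → f 0 ≡ 0ℤ → f j ≢ 0ℤ → (∀ i → B < i → f i ≡ 0ℤ) →
              ∃ λ r → f (suc r) ≢ 0ℤ × (∀ i → suc r < i → f i ≡ 0ℤ)
last-nonzero f zero    {zero}  f0≡0 f0≢0 vanish = contradiction f0≡0 f0≢0
last-nonzero f zero    {suc j} f0≡0 fj≢0 vanish = contradiction (vanish (suc j) (s≤s z≤n)) fj≢0
last-nonzero f (suc B)         f0≡0 fj≢0 vanish with f (suc B) ℤ.≟ 0ℤ
... | no  f[1+B]≢0 = B , f[1+B]≢0 , vanish
... | yes f[1+B]≡0 = last-nonzero f B f0≡0 fj≢0 vanish′
  where
  vanish′ : ∀ i → B < i → f i ≡ 0ℤ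
  vanish′ i B<i with ℕ.m≤n⇒m<n∨m≡n B<i
  ... | inj₁ 1+B<i = vanish i 1+B<i
  ... | inj₂ refl  = f[1+B]≡0

-- (t , e) stands for the monomial x^e of c (suc t), whose slope is e / (t + 1).
slope : ℕ × ℕ → ℚᵘ
slope (t , e) = mkℚᵘ (+ e) t

slope-≤ : ∀ {t e t′ e′} → slope (t , e) ≤ℚ slope (t′ , e′) → e * suc t′ ≤ e′ * suc t
slope-≤ {t} {e} {t′} {e′} (*≤* le) =
  ℤ.drop‿+≤+ (subst₂ _≤ℤ_ (sym (ℤ.pos-* e (suc t′))) (sym (ℤ.pos-* e′ (suc t))) le)

module _ (n : ℕ) (a : Fin n → Poly) where
  open PowerSums n a

  Steepest : ℕ → ℕ → Set
  Steepest i₀ d = ∀ i e → coeff (c i) e ≢ 0ℤ → e * i₀ ≤ d * i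

  NonzeroAt : ℕ × ℕ → Set
  NonzeroAt te = coeff (c (suc (proj₁ te))) (proj₂ te) ≢ 0ℤ

  steepest : ∀ {t} → Nonconstant (c (suc t)) →
             ∃ λ t₀ → ∃ λ d → 1 ≤ d × coeff (c (suc t₀)) d ≢ 0ℤ × Steepest (suc t₀) d
  steepest {t} (e , ne) =
    proj₁ top , proj₂ top , 1≤d , argmax-all slope {P = NonzeroAt} ne (all-filter nonzero? grid) , maximal
    where
    nonzero? : ∀ te → Dec (NonzeroAt te)
    nonzero? (t , e) = ¬? (coeff (c (suc t)) e ℤ.≟ 0ℤ)
    grid = cartesianProduct (upTo (length cs)) (upTo (sum (map length cs)))
    support = filter nonzero? grid
    top = argmax slope (t , suc e) support
    maximal : Steepest (suc (proj₁ top)) (proj₂ top)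
    maximal zero     e′ ne′ = contradiction refl ne′
    maximal (suc t′) e′ ne′ with nth-coeff≢0⇒bounded cs t′ e′ ne′
    ... | t′<n , e′<D = slope-≤ (All.lookup (f[xs]≤f[argmax] {f = slope} (t , suc e) support)
                          (∈-filter⁺ nonzero? (∈-cartesianProduct⁺ (∈-upTo⁺ t′<n) (∈-upTo⁺ e′<D)) ne′))
    1≤d : 1 ≤ proj₂ top
    1≤d with proj₂ top | maximal (suc t) (suc e) ne
    ... | zero  | ()
    ... | suc _ | _ = s≤s z≤n

  c-nonconstant : (∃ λ j → Nonconstant (a j)) → ∃ λ t → Nonconstant (c (suc t))
  c-nonconstant (j , nonconstant) =
    Any-nth {P = Nonconstant} (Any.reverse⁺ (Any.map⁺ {f = a} (lose (∈-allFin j) nonconstant)))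

  c-beyond : ∀ i → length cs < i → c i ≡ 0ᴾ
  c-beyond (suc t) n<1+t = nth-beyond cs t (ℕ.≤-pred n<1+t)
    where
    nth-beyond : ∀ As t → length As ≤ t → nth As 0ᴾ t ≡ 0ᴾ
    nth-beyond []       t       _            = refl
    nth-beyond (A ∷ As) (suc t) (s≤s len≤t) = nth-beyond As t len≤t

  module _ (i₀ d : ℕ) .{{_ : NonZero i₀}} where
    open Weighted i₀ d

    topCoeff : ℕ → ℤ
    topCoeff i = top (c i) i

    Leading-c : Steepest i₀ d → ∀ i → Leading (c i) i (topCoeff i)
    Leading-c steep i = Leading-top bounded
      where
      bounded : Bounded (c i) i
      bounded e d·i<i₀·e with coeff (c i) e ℤ.≟ 0ℤ
      ... | yes coeff≡0 = coeff≡0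
      ... | no  coeff≢0 = contradiction (subst (_≤ d * i) (ℕ.*-comm e i₀) (steep i e coeff≢0)) (ℕ.<⇒≱ d·i<i₀·e)

    topCoeff≢0 : Steepest i₀ d → coeff (c i₀) d ≢ 0ℤ → topCoeff i₀ ≢ 0ℤ
    topCoeff≢0 steep coeff≢0 = coeff≢0 ∘ trans (Leading.at (Leading-c steep i₀) d (ℕ.*-comm i₀ d))

    topCoeff-beyond : ∀ i → length cs < i → topCoeff i ≡ 0ℤ
    topCoeff-beyond i n<i = trans (cong (λ A → top A i) (c-beyond i n<i)) (top-0ᴾ i)

  Q-nonconstant : ∀ {i₀ d} .{{_ : NonZero i₀}} → 1 ≤ d → coeff (c i₀) d ≢ 0ℤ → Steepest i₀ d →
                  ∀ N → 1 ≤ N → ∃ λ k → 1 ≤ k × Nonconstant (Q (k * N) n a)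
  Q-nonconstant {i₀} {d} d≥1 coeff≢0 steep N N≥1
    with last-nonzero (topCoeff i₀ d) (length cs) (Weighted.top-0ᴾ i₀ d 0)
                      (topCoeff≢0 i₀ d steep coeff≢0) (topCoeff-beyond i₀ d)
  ... | r , h-top≢0 , h-vanishes = Q-nonconstant-at
    (NonzeroRoots.P-nonvanishing-on-multiples h r h-top≢0 h-vanishes (i₀ * N) (ℕ.*-mono-≤ (>-nonZero⁻¹ i₀) N≥1))
    where
    h = topCoeff i₀ d
    open PowerSumsℤ h using (P)
    Q-nonconstant-at : (∃ λ π → 1 ≤ π × P (π * (i₀ * N)) ≢ 0ℤ) →
                       ∃ λ k → 1 ≤ k × Nonconstant (Q (k * N) n a)
    Q-nonconstant-at (π , π≥1 , P≢0) =
      π * i₀ , ℕ.*-mono-≤ π≥1 (>-nonZero⁻¹ i₀) ,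
      coeff≢0⇒Nonconstant (Q (π * i₀ * N) n a) (π * (d * N)) (ℕ.*-mono-≤ π≥1 (ℕ.*-mono-≤ d≥1 N≥1)) Q-coeff≢0
      where
      open ≡-Reasoning
      regroup : ∀ i₀ π d N → i₀ * (π * (d * N)) ≡ d * (π * i₀ * N)
      regroup = ℕ-solve-∀
      Q-coeff≢0 : coeff (Q (π * i₀ * N) n a) (π * (d * N)) ≢ 0ℤ
      Q-coeff≢0 coeff≡0 = P≢0 (begin
        P (π * (i₀ * N))                         ≡⟨ cong P (ℕ.*-assoc π i₀ N) ⟨
        P (π * i₀ * N)                           ≡⟨ Weighted.Leading.at (Leading-Q n a i₀ d h (Leading-c i₀ d steep) (π * i₀ * N))
                                                                        (π * (d * N)) (regroup i₀ π d N) ⟨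
        coeff (Q (π * i₀ * N) n a) (π * (d * N)) ≡⟨ coeff≡0 ⟩
        0ℤ                                       ∎)

lemma3p4 : (n : ℕ) → 1 ≤ n → (N₀ : ℤ) → (p : Fin n → Poly)
           → (∃ λ j → Nonconstant (p j))
           → (N : ℕ) → 1 ≤ N
           → ∃ λ k → 1 ≤ k × Nonconstant (Q (k * N) n p)
lemma3p4 n _ _ p nonconstant N N≥1 with steepest n p (proj₂ (c-nonconstant n p nonconstant))
... | _ , _ , d≥1 , coeff≢0 , steep = Q-nonconstant n p d≥1 coeff≢0 steep N N≥1
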